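{- Let $G_1$ and $G_2$ be two finite simple graphs on the same vertex set $V$. Then $G_1$ and $G_2$ are degree-similar if and only if there exist relabelings of the vertices of $G_1$ and of $G_2$ (i.e. permutation matrices $P,P'$, replacing $A(G_1)$ by $PA(G_1)P^\top$ and $A(G_2)$ by $P'A(G_2)P'^\top$) after which the following hold: $G_1$ and $G_2$ have the same degree partition $\pi=\{V_1,\ldots,V_t\}$, and there exist invertible matrices $M_1,\ldots,M_t$, where $M_i$ has rows and columns indexed by $V_i$, such that $$M_i^{ -1}A(G_1)[V_i|V_j]\,M_j=A(G_2)[V_i|V_j]\quad\text{for all } i,j\in\{1,\ldots,t\}.$$
   Context: For a graph $G$, $A(G)$ is its adjacency matrix and $D(G)$ its diagonal degree matrix. Two graphs $G_1,G_2$ (on the same number of vertices) are degree-similar if there is an invertible real matrix $M$ with $M^{ -1}A(G_1)M=A(G_2)$ and $M^{ -1}D(G_1)M=D(G_2)$. If $G$ has exactly $t$ distinct vertex degrees $d_1,\ldots,d_t$, its degree partition is $\pi(G)=\{V_1,\ldots,V_t\}$ with $V_i=\{v\in V(G):\deg_G(v)=d_i\}$. For a matrix $N$ indexed by $V(G)$ and $U_1,U_2\subseteq V(G)$, $N[U_1|U_2]$ is the submatrix with rows indexed by $U_1$ and columns indexed by $U_2$. -}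

module Defs where

open import Level using (Level; _⊔_; suc)
open import Data.Bool using (Bool; true; false; if_then_else_)
open import Data.Nat as ℕ using (ℕ; zero) renaming (suc to sucℕ)
open import Data.Fin using (Fin; _≟_)
open import Data.Fin.Permutation using (Permutation′; _⟨$⟩ʳ_)
open import Data.List using (map; allFin)
open import Data.Nat.ListAction using () renaming (sum to sumℕ)
open import Data.Product using (Σ; _×_; ∃)
open import Relation.Nullary using (¬_; does)
open import Relation.Binary.PropositionalEquality using (_≡_)
open import Algebra.Bundles using (CommutativeRing)
import Algebra.Definitions.RawMonoid as RM

record Field (c ℓ : Level) : Set (Level.suc (c ⊔ ℓ)) where
  field
    commutativeRing : CommutativeRing c ℓ
  open CommutativeRing commutativeRing public
  field
    0≉1     : ¬ (0# ≈ 1#)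
    inverse : ∀ x → ¬ (x ≈ 0#) → ∃ λ y → x * y ≈ 1#

record Graph (n : ℕ) : Set where
  field
    adj    : Fin n → Fin n → Bool
    sym    : ∀ i j → adj i j ≡ adj j i
    irrefl : ∀ i → adj i i ≡ false
open Graph public

degree : ∀ {n} → Graph n → Fin n → ℕ
degree {n} G v = sumℕ (map (λ j → if adj G v j then 1 else 0) (allFin n))

-- relabelling of the vertices by a permutation σ (i.e. P A P^T)
relabel : ∀ {n} → Permutation′ n → Graph n → Graph n
relabel σ G = record
  { adj    = λ i j → adj G (σ ⟨$⟩ʳ i) (σ ⟨$⟩ʳ j)
  ; sym    = λ i j → sym G (σ ⟨$⟩ʳ i) (σ ⟨$⟩ʳ j)
  ; irrefl = λ i → irrefl G (σ ⟨$⟩ʳ i)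
  }

module MatrixOver {c ℓ} (F : Field c ℓ) where
  open Field F
  open RM +-rawMonoid using (sum)

  Mat : ℕ → Set c
  Mat n = Fin n → Fin n → Carrier

  embed : ℕ → Carrier
  embed zero = 0#
  embed (sucℕ k) = 1# + embed k

  CharZero : Set ℓ
  CharZero = ∀ k → ¬ (embed (sucℕ k) ≈ 0#)

  infixl 7 _⊛_
  _⊛_ : ∀ {n} → Mat n → Mat n → Mat n
  (X ⊛ Y) i j = sum (λ k → X i k * Y k j)

  I : ∀ {n} → Mat n
  I i j = if does (i ≟ j) then 1# else 0#

  infix 4 _≋_
  _≋_ : ∀ {n} → Mat n → Mat n → Set ℓ
  X ≋ Y = ∀ i j → X i j ≈ Y i j

  A : ∀ {n} → Graph n → Mat n
  A G i j = if adj G i j then 1# else 0#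

  D : ∀ {n} → Graph n → Mat n
  D G i j = if does (i ≟ j) then embed (degree G i) else 0#

  DegreeSimilar : ∀ {n} → Graph n → Graph n → Set (c ⊔ ℓ)
  DegreeSimilar {n} G₁ G₂ =
    Σ (Mat n) λ M → Σ (Mat n) λ N →
      (M ⊛ N ≋ I) × (N ⊛ M ≋ I) ×
      (N ⊛ A G₁ ⊛ M ≋ A G₂) × (N ⊛ D G₁ ⊛ M ≋ D G₂)

  -- product of X[U1|V_d] and Y[V_d|U2], where V_d = {v : deg_G v = d}:
  -- the summation index ranges over V_d only.
  blockMul : ∀ {n} → Graph n → ℕ → Mat n → Mat n → Mat n
  blockMul G d X Y i j =
    sum (λ k → if does (degree G k ℕ.≟ d) then X i k * Y k j else 0#)

  -- After relabelling: G₁, G₂ have the same degree partition (with the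
  -- same degree on each class, V_d = {v : deg v = d}), and there are
  -- invertible M_d (rows/columns indexed by V_d, inverse N_d) with
  -- M_d^{-1} A(G₁)[V_d|V_e] M_e = A(G₂)[V_d|V_e] for all classes d, e.
  -- (Degrees d not occurring give empty classes, where all conditions
  -- are vacuous.)
  BlockSimilar : ∀ {n} → Graph n → Graph n → Set (c ⊔ ℓ)
  BlockSimilar {n} G₁ G₂ =
    (∀ v → degree G₁ v ≡ degree G₂ v) ×
    Σ (ℕ → Mat n) λ M → Σ (ℕ → Mat n) λ N →
      (∀ d u w → degree G₁ u ≡ d → degree G₁ w ≡ d →
         blockMul G₁ d (M d) (N d) u w ≈ I u w) ×
      (∀ d u w → degree G₁ u ≡ d → degree G₁ w ≡ d →
         blockMul G₁ d (N d) (M d) u w ≈ I u w) ×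
      (∀ d e u w → degree G₁ u ≡ d → degree G₁ w ≡ e →
         blockMul G₁ d (N d) (blockMul G₁ e (A G₁) (M e)) u w ≈ A G₂ u w)

  RelabelledBlockSimilar : ∀ {n} → Graph n → Graph n → Set (c ⊔ ℓ)
  RelabelledBlockSimilar {n} G₁ G₂ =
    Σ (Permutation′ n) λ σ₁ → Σ (Permutation′ n) λ σ₂ →
      BlockSimilar (relabel σ₁ G₁) (relabel σ₂ G₂)

-- Write δ₁, δ₂ for the degree functions. If N A(G₁) M = A(G₂) and N D(G₁) M = D(G₂)
-- with N = M⁻¹, then D(G₁) M = M D(G₂), so M[u,v] (δ₁ u − δ₂ v) = 0 and, in a field of
-- characteristic zero, M[u,v] = 0 unless δ₁ u = δ₂ v; likewise for N. Comparing traces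
-- of MN and NM restricted to the vertices of a fixed degree shows that both graphs have
-- the same number of vertices of each degree, so after relabelling G₁ the degree
-- functions coincide and M, N are block diagonal for the common degree partition; their
-- diagonal blocks then conjugate each block of A(G₁) to the block of A(G₂).
-- Conversely, block-diagonal matrices assembled from the blocks Mᵢ commute with D(G₁),
-- which turns the blockwise conditions into degree-similarity.
module Submission where

open import Data.Bool using (true; false; if_then_else_)
open import Data.Empty using (⊥-elim)
open import Data.Fin using (Fin; _≟_; punchIn) renaming (zero to fzero; suc to fsuc)
open import Data.Fin.Permutation as Perm using (Permutation′; _⟨$⟩ʳ_; _⟨$⟩ˡ_; insert; inverseˡ; inverseʳ)
open import Data.List using (map; allFin; tabulate)
open import Data.List.Properties using (map-tabulate)
open import Data.Nat as ℕ using (ℕ; zero; suc; _<_; z≤n; s≤s)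
open import Data.Nat.ListAction using () renaming (sum to sumℕ)
open import Data.Nat.Properties using (+-0-commutativeMonoid; +-cancelˡ-≡)
open import Data.Product using (Σ; ∃; _,_; proj₁; proj₂)
open import Function using (_∘_; id; _⇔_; mk⇔)
open import Relation.Binary.Bundles using (Setoid)
open import Relation.Binary.Definitions using (DecidableEquality)
open import Relation.Binary.PropositionalEquality as ≡ using (_≡_; _≢_; refl; cong)
open import Relation.Nullary using (¬_; Dec; does; yes; no)
open import Relation.Nullary.Decidable using (dec-true; dec-false; does-≡; map′)
import Algebra.Properties.CommutativeMonoid.Sum as CommutativeMonoidSum
import Algebra.Properties.Group as GroupProperties
import Algebra.Properties.Ring as RingProperties
import Algebra.Properties.Semiring.Sum as SemiringSum
import Relation.Binary.Reasoning.Setoid as SetoidReasoning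

open import Defs

module ℕSum = CommutativeMonoidSum +-0-commutativeMonoid

sumℕ-allFin : ∀ n (h : Fin n → ℕ) → sumℕ (map h (allFin n)) ≡ ℕSum.sum h
sumℕ-allFin n h = ≡.trans (cong sumℕ (map-tabulate id h)) (sumℕ-tabulate n h)
  where
  sumℕ-tabulate : ∀ n (h : Fin n → ℕ) → sumℕ (tabulate h) ≡ ℕSum.sum h
  sumℕ-tabulate zero    h = refl
  sumℕ-tabulate (suc n) h = cong (h fzero ℕ.+_) (sumℕ-tabulate n (h ∘ fsuc))

-- Relabellings

IsRelabelling : ∀ {n} → Permutation′ n → Graph n → Graph n → Set
IsRelabelling σ G G′ = ∀ i j → adj G′ i j ≡ adj G (σ ⟨$⟩ʳ i) (σ ⟨$⟩ʳ j)

relabel-isRelabelling : ∀ {n} (σ : Permutation′ n) (G : Graph n) → IsRelabelling σ G (relabel σ G)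
relabel-isRelabelling σ G i j = refl

flip-isRelabelling : ∀ {n} (σ : Permutation′ n) (G : Graph n) →
  IsRelabelling (Perm.flip σ) (relabel σ G) G
flip-isRelabelling σ G i j = ≡.sym (≡.cong₂ (adj G) (inverseʳ σ) (inverseʳ σ))

degree-relabel : ∀ {n} (σ : Permutation′ n) {G G′ : Graph n} → IsRelabelling σ G G′ →
  ∀ v → degree G′ v ≡ degree G (σ ⟨$⟩ʳ v)
degree-relabel σ {G} {G′} σ-rel v = begin
  degree G′ v
    ≡⟨ sumℕ-allFin _ (neighbour G′ v) ⟩
  ℕSum.sum (neighbour G′ v)
    ≡⟨ ℕSum.sum-cong-≗ (cong (λ b → if b then 1 else 0) ∘ σ-rel v) ⟩
  ℕSum.sum (neighbour G (σ ⟨$⟩ʳ v) ∘ (σ ⟨$⟩ʳ_))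
    ≡⟨ ℕSum.∑-permute (neighbour G (σ ⟨$⟩ʳ v)) σ ⟨
  ℕSum.sum (neighbour G (σ ⟨$⟩ʳ v))
    ≡⟨ sumℕ-allFin _ (neighbour G (σ ⟨$⟩ʳ v)) ⟨
  degree G (σ ⟨$⟩ʳ v)
    ∎
  where
  open ≡.≡-Reasoning
  neighbour : Graph _ → Fin _ → Fin _ → ℕ
  neighbour H u j = if adj H u j then 1 else 0

does-permute : ∀ {n} (σ : Permutation′ n) u w → does (σ ⟨$⟩ʳ u ≟ σ ⟨$⟩ʳ w) ≡ does (u ≟ w)
does-permute σ u w = does-≡ (σ ⟨$⟩ʳ u ≟ σ ⟨$⟩ʳ w) (map′ (cong (σ ⟨$⟩ʳ_)) σ-injective (u ≟ w))
  where
  σ-injective : ∀ {u w} → σ ⟨$⟩ʳ u ≡ σ ⟨$⟩ʳ w → u ≡ w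
  σ-injective {u} {w} e = ≡.trans (≡.sym (inverseˡ σ)) (≡.trans (cong (σ ⟨$⟩ˡ_) e) (inverseˡ σ))

-- Counting

module Counting {a} {A : Set a} (_≟ᴬ_ : DecidableEquality A) where

  indicator : A → A → ℕ
  indicator x e = if does (x ≟ᴬ e) then 1 else 0

  count : ∀ {n} → (Fin n → A) → A → ℕ
  count f e = ℕSum.sum (λ v → indicator (f v) e)

  preimage : ∀ {n} (f : Fin n → A) e → 0 < count f e → ∃ λ i → f i ≡ e
  preimage {suc n} f e pos with f fzero ≟ᴬ e
  ... | yes f0≡e = fzero , f0≡e
  ... | no _     = let i , fi≡e = preimage (f ∘ fsuc) e pos in fsuc i , fi≡e

  permutation-from-count : ∀ {n} (f g : Fin n → A) → (∀ e → count f e ≡ count g e) →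
    Σ (Permutation′ n) λ π → ∀ v → f (π ⟨$⟩ʳ v) ≡ g v
  permutation-from-count {zero}  f g _    = Perm.id , λ ()
  permutation-from-count {suc n} f g same = insert fzero i π , f∘π≗g
    where
    g0-counted : 0 < count g (g fzero)
    g0-counted rewrite dec-true (g fzero ≟ᴬ g fzero) refl = s≤s z≤n

    g0-image : ∃ λ i → f i ≡ g fzero
    g0-image = preimage f (g fzero) (≡.subst (0 <_) (≡.sym (same (g fzero))) g0-counted)

    i : Fin (suc n)
    i = proj₁ g0-image

    fi≡g0 : f i ≡ g fzero
    fi≡g0 = proj₂ g0-image

    same-rest : ∀ e → count (f ∘ punchIn i) e ≡ count (g ∘ fsuc) e
    same-rest e = +-cancelˡ-≡ (indicator (g fzero) e) _ _ (begin
      indicator (g fzero) e ℕ.+ count (f ∘ punchIn i) e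
        ≡⟨ cong (λ x → indicator x e ℕ.+ count (f ∘ punchIn i) e) fi≡g0 ⟨
      indicator (f i) e ℕ.+ count (f ∘ punchIn i) e
        ≡⟨ ℕSum.sum-remove (λ v → indicator (f v) e) ⟨
      count f e
        ≡⟨ same e ⟩
      count g e
        ∎)
      where open ≡.≡-Reasoning

    rest = permutation-from-count (f ∘ punchIn i) (g ∘ fsuc) same-rest
    π = proj₁ rest

    f∘π≗g : ∀ v → f (insert fzero i π ⟨$⟩ʳ v) ≡ g v
    f∘π≗g fzero    = fi≡g0
    f∘π≗g (fsuc v) = proj₂ rest v

open Counting ℕ._≟_ using (count; permutation-from-count)

module _ {c ℓ} (F : Field c ℓ) where

  open Field F hiding (refl; sym; trans)
  open MatrixOver F
  open SemiringSum semiring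
    using (sum; sum-cong-≋; sum-replicate-zero; ∑-comm; ∑-permute; *-distribˡ-sum; *-distribʳ-sum)
  open GroupProperties +-group using (∙-cancelˡ; x∙y⁻¹≈ε⇒x≈y; x≈y⇒x∙y⁻¹≈ε)
  open RingProperties ring using (x[y-z]≈xy-xz)
  private
    module ≈ = Setoid setoid
    module ≈-Reasoning = SetoidReasoning setoid

  if-*ʳ : ∀ b x y → (if b then x else 0#) * y ≈ (if b then x * y else 0#)
  if-*ʳ true  x y = ≈.refl
  if-*ʳ false x y = zeroˡ y

  if-*ˡ : ∀ b x y → x * (if b then y else 0#) ≈ (if b then x * y else 0#)
  if-*ˡ true  x y = ≈.refl
  if-*ˡ false x y = zeroʳ x

  if-cong : ∀ {p} {P : Set p} (P? : Dec P) {x y} → (P → x ≈ y) →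
    (if does P? then x else 0#) ≈ (if does P? then y else 0#)
  if-cong (yes p) x≈y = x≈y p
  if-cong (no _)  x≈y = ≈.refl

  if-redundant : ∀ {p} {P : Set p} (P? : Dec P) {x} → (¬ P → x ≈ 0#) →
    (if does P? then x else 0#) ≈ x
  if-redundant (yes _) x≈0 = ≈.refl
  if-redundant (no ¬p) x≈0 = ≈.sym (x≈0 ¬p)

  sum-zero : ∀ {n} {f : Fin n → Carrier} → (∀ i → f i ≈ 0#) → sum f ≈ 0#
  sum-zero {n} f≈0 = ≈.trans (sum-cong-≋ f≈0) (sum-replicate-zero n)

  sum-δˡ : ∀ {n} (i : Fin n) (x : Fin n → Carrier) →
    sum (λ k → if does (i ≟ k) then x k else 0#) ≈ x i
  sum-δˡ {suc n} fzero x = ≈.trans (+-congˡ (sum-replicate-zero n)) (+-identityʳ _)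
  sum-δˡ (fsuc i) x = ≈.trans (+-identityˡ _) (sum-δˡ i (x ∘ fsuc))

  sum-δʳ : ∀ {n} (i : Fin n) (x : Fin n → Carrier) →
    sum (λ k → if does (k ≟ i) then x k else 0#) ≈ x i
  sum-δʳ {suc n} fzero x = ≈.trans (+-congˡ (sum-replicate-zero n)) (+-identityʳ _)
  sum-δʳ (fsuc i) x = ≈.trans (+-identityˡ _) (sum-δʳ i (x ∘ fsuc))

  I-diagonal : ∀ {n} (u : Fin n) → I u u ≈ 1#
  I-diagonal u = ≈.reflexive (cong (λ b → if b then 1# else 0#) (dec-true (u ≟ u) refl))

  I-offDiagonal : ∀ {n} {u w : Fin n} → u ≢ w → I u w ≈ 0#
  I-offDiagonal {u = u} {w} u≢w =
    ≈.reflexive (cong (λ b → if b then 1# else 0#) (dec-false (u ≟ w) u≢w))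

  ≋-setoid : ℕ → Setoid c ℓ
  ≋-setoid n = record
    { Carrier       = Mat n
    ; _≈_           = _≋_
    ; isEquivalence = record
      { refl  = λ _ _ → ≈.refl
      ; sym   = λ X≋Y i j → ≈.sym (X≋Y i j)
      ; trans = λ X≋Y Y≋Z i j → ≈.trans (X≋Y i j) (Y≋Z i j)
      }
    }

  private
    module ≋ {n} = Setoid (≋-setoid n)
    module ≋-Reasoning {n} = SetoidReasoning (≋-setoid n)

  ⊛-cong : ∀ {n} {X X′ Y Y′ : Mat n} → X ≋ X′ → Y ≋ Y′ → X ⊛ Y ≋ X′ ⊛ Y′
  ⊛-cong X≋X′ Y≋Y′ i j = sum-cong-≋ λ k → *-cong (X≋X′ i k) (Y≋Y′ k j)

  ⊛-identityˡ : ∀ {n} (X : Mat n) → I ⊛ X ≋ X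
  ⊛-identityˡ X i j = ≈.trans (sum-cong-≋ λ k → if-*ʳ (does (i ≟ k)) 1# (X k j))
                              (≈.trans (sum-δˡ i (λ k → 1# * X k j)) (*-identityˡ _))

  ⊛-identityʳ : ∀ {n} (X : Mat n) → X ⊛ I ≋ X
  ⊛-identityʳ X i j = ≈.trans (sum-cong-≋ λ k → if-*ˡ (does (k ≟ j)) (X i k) 1#)
                              (≈.trans (sum-δʳ j (λ k → X i k * 1#)) (*-identityʳ _))

  ⊛-assoc : ∀ {n} (X Y Z : Mat n) → X ⊛ Y ⊛ Z ≋ X ⊛ (Y ⊛ Z)
  ⊛-assoc X Y Z i j = begin
    sum (λ l → sum (λ k → X i k * Y k l) * Z l j)
      ≈⟨ sum-cong-≋ (λ l → *-distribʳ-sum (Z l j) (λ k → X i k * Y k l)) ⟩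
    sum (λ l → sum (λ k → X i k * Y k l * Z l j))
      ≈⟨ ∑-comm (λ l k → X i k * Y k l * Z l j) ⟩
    sum (λ k → sum (λ l → X i k * Y k l * Z l j))
      ≈⟨ sum-cong-≋ (λ k → sum-cong-≋ λ l → *-assoc (X i k) (Y k l) (Z l j)) ⟩
    sum (λ k → sum (λ l → X i k * (Y k l * Z l j)))
      ≈⟨ sum-cong-≋ (λ k → *-distribˡ-sum (X i k) (λ l → Y k l * Z l j)) ⟨
    sum (λ k → X i k * sum (λ l → Y k l * Z l j))
      ∎
    where open ≈-Reasoning

  module _ {n} {M N : Mat n} (M⊛N≋I : M ⊛ N ≋ I) where

    ⊛-cancelˡ : ∀ X → M ⊛ (N ⊛ X) ≋ X
    ⊛-cancelˡ X = begin
      M ⊛ (N ⊛ X)  ≈⟨ ⊛-assoc M N X ⟨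
      M ⊛ N ⊛ X    ≈⟨ ⊛-cong M⊛N≋I ≋.refl ⟩
      I ⊛ X        ≈⟨ ⊛-identityˡ X ⟩
      X            ∎
      where open ≋-Reasoning

    conjugate-intertwines : ∀ {X Y} → N ⊛ X ⊛ M ≋ Y → X ⊛ M ≋ M ⊛ Y
    conjugate-intertwines {X} {Y} conj = begin
      X ⊛ M              ≈⟨ ⊛-cong (⊛-cancelˡ X) ≋.refl ⟨
      M ⊛ (N ⊛ X) ⊛ M    ≈⟨ ⊛-assoc M (N ⊛ X) M ⟩
      M ⊛ (N ⊛ X ⊛ M)    ≈⟨ ⊛-cong ≋.refl conj ⟩
      M ⊛ Y              ∎
      where open ≋-Reasoning

    conjugate-inverse : ∀ {X Y} → N ⊛ X ⊛ M ≋ Y → M ⊛ Y ⊛ N ≋ X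
    conjugate-inverse {X} {Y} conj = begin
      M ⊛ Y ⊛ N      ≈⟨ ⊛-cong (conjugate-intertwines conj) ≋.refl ⟨
      X ⊛ M ⊛ N      ≈⟨ ⊛-assoc X M N ⟩
      X ⊛ (M ⊛ N)    ≈⟨ ⊛-cong ≋.refl M⊛N≋I ⟩
      X ⊛ I          ≈⟨ ⊛-identityʳ X ⟩
      X              ∎
      where open ≋-Reasoning

  DegreeSimilar-sym : ∀ {n} {G H : Graph n} → DegreeSimilar G H → DegreeSimilar H G
  DegreeSimilar-sym (M , N , M⊛N≋I , N⊛M≋I , A-conj , D-conj) =
    N , M , N⊛M≋I , M⊛N≋I , conjugate-inverse M⊛N≋I A-conj , conjugate-inverse M⊛N≋I D-conj

  -- Conjugation by permutation matrices

  permuteRows permuteCols permute : ∀ {n} → Permutation′ n → Mat n → Mat n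
  permuteRows σ X i j = X (σ ⟨$⟩ʳ i) j
  permuteCols σ X i j = X i (σ ⟨$⟩ʳ j)
  permute     σ X i j = X (σ ⟨$⟩ʳ i) (σ ⟨$⟩ʳ j)

  permuteCols-⊛-permuteRows : ∀ {n} (σ : Permutation′ n) (X Y : Mat n) →
    permuteCols σ X ⊛ permuteRows σ Y ≋ X ⊛ Y
  permuteCols-⊛-permuteRows σ X Y i j = ≈.sym (∑-permute (λ k → X i k * Y k j) σ)

  permute-conjugate : ∀ {n} (σ : Permutation′ n) (M N X : Mat n) →
    permuteCols σ N ⊛ permute σ X ⊛ permuteRows σ M ≋ N ⊛ X ⊛ M
  permute-conjugate σ M N X =
    ≋.trans (⊛-cong (permuteCols-⊛-permuteRows σ N (permuteCols σ X)) ≋.refl)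
            (permuteCols-⊛-permuteRows σ (N ⊛ X) M)

  permute-I : ∀ {n} (σ : Permutation′ n) → permute σ I ≋ I
  permute-I σ u w = ≈.reflexive (cong (λ b → if b then 1# else 0#) (does-permute σ u w))

  A-relabel : ∀ {n} (σ : Permutation′ n) {G G′ : Graph n} → IsRelabelling σ G G′ →
    A G′ ≋ permute σ (A G)
  A-relabel σ σ-rel k l = ≈.reflexive (cong (λ b → if b then 1# else 0#) (σ-rel k l))

  D-relabel : ∀ {n} (σ : Permutation′ n) {G G′ : Graph n} → IsRelabelling σ G G′ →
    D G′ ≋ permute σ (D G)
  D-relabel σ {G} {G′} σ-rel k l = ≈.reflexive (≡.cong₂ (λ b x → if b then embed x else 0#)
    (≡.sym (does-permute σ k l)) (degree-relabel σ {G} {G′} σ-rel k))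

  DegreeSimilar-relabel : ∀ {n} (σ : Permutation′ n) {G G′ H : Graph n} → IsRelabelling σ G G′ →
    DegreeSimilar G H → DegreeSimilar G′ H
  DegreeSimilar-relabel σ {G} {G′} σ-rel (M , N , M⊛N≋I , N⊛M≋I , A-conj , D-conj) =
    permuteRows σ M , permuteCols σ N ,
    ≋.trans (λ u w → M⊛N≋I (σ ⟨$⟩ʳ u) (σ ⟨$⟩ʳ w)) (permute-I σ) ,
    ≋.trans (permuteCols-⊛-permuteRows σ N M) N⊛M≋I ,
    ≋.trans (conjugate-cong (A-relabel σ {G} {G′} σ-rel)) (≋.trans (permute-conjugate σ M N (A G)) A-conj) ,
    ≋.trans (conjugate-cong (D-relabel σ {G} {G′} σ-rel)) (≋.trans (permute-conjugate σ M N (D G)) D-conj)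
    where
    conjugate-cong : ∀ {X Y} → X ≋ Y →
      permuteCols σ N ⊛ X ⊛ permuteRows σ M ≋ permuteCols σ N ⊛ Y ⊛ permuteRows σ M
    conjugate-cong X≋Y = ⊛-cong (⊛-cong ≋.refl X≋Y) ≋.refl

  DegreeSimilar-unrelabel : ∀ {n} (σ : Permutation′ n) {G H : Graph n} →
    DegreeSimilar (relabel σ G) H → DegreeSimilar G H
  DegreeSimilar-unrelabel σ {G} {H} =
    DegreeSimilar-relabel (Perm.flip σ) {relabel σ G} {G} {H} (flip-isRelabelling σ G)

  -- Matrices respecting degree classes

  D-⊛ : ∀ {n} (G : Graph n) (X : Mat n) u v → (D G ⊛ X) u v ≈ embed (degree G u) * X u v
  D-⊛ G X u v = ≈.trans (sum-cong-≋ λ k → if-*ʳ (does (u ≟ k)) (embed (degree G u)) (X k v))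
                        (sum-δˡ u (λ k → embed (degree G u) * X k v))

  ⊛-D : ∀ {n} (G : Graph n) (X : Mat n) u v → (X ⊛ D G) u v ≈ X u v * embed (degree G v)
  ⊛-D G X u v = ≈.trans (sum-cong-≋ λ k → if-*ˡ (does (k ≟ v)) (X u k) (embed (degree G k)))
                        (sum-δʳ v (λ k → X u k * embed (degree G k)))

  D-cong : ∀ {n} {G H : Graph n} → (∀ v → degree G v ≡ degree H v) → D G ≋ D H
  D-cong δ≗δ′ u w = ≈.reflexive (cong (λ z → if does (u ≟ w) then embed z else 0#) (δ≗δ′ u))

  BlockDiagonal : ∀ {n} → (Fin n → ℕ) → (Fin n → ℕ) → Mat n → Set ℓ
  BlockDiagonal δ δ′ X = ∀ u v → δ u ≢ δ′ v → X u v ≈ 0#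

  module Blocks {n} (G : Graph n) where

    private
      δ : Fin n → ℕ
      δ = degree G

    ⊛≈blockMulˡ : ∀ {X} Y → BlockDiagonal δ δ X → ∀ u w →
      (X ⊛ Y) u w ≈ blockMul G (δ u) X Y u w
    ⊛≈blockMulˡ Y X-bd u w = sum-cong-≋ λ k → ≈.sym (if-redundant (δ k ℕ.≟ δ u)
      λ δk≢δu → ≈.trans (*-congʳ (X-bd u k (δk≢δu ∘ ≡.sym))) (zeroˡ _))

    ⊛≈blockMulʳ : ∀ X {Y} → BlockDiagonal δ δ Y → ∀ u w →
      (X ⊛ Y) u w ≈ blockMul G (δ w) X Y u w
    ⊛≈blockMulʳ X Y-bd u w = sum-cong-≋ λ k → ≈.sym (if-redundant (δ k ℕ.≟ δ w)
      λ δk≢δw → ≈.trans (*-congˡ (Y-bd k w δk≢δw)) (zeroʳ _))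

    blockMul-cong : ∀ {d} X X′ Y Y′ {u w} →
      (∀ k → δ k ≡ d → X u k * Y k w ≈ X′ u k * Y′ k w) →
      blockMul G d X Y u w ≈ blockMul G d X′ Y′ u w
    blockMul-cong {d} X X′ Y Y′ eq = sum-cong-≋ λ k → if-cong (δ k ℕ.≟ d) (eq k)

    ⊛-blockDiagonal : ∀ {X Y} → BlockDiagonal δ δ X → BlockDiagonal δ δ Y →
      BlockDiagonal δ δ (X ⊛ Y)
    ⊛-blockDiagonal {X} {Y} X-bd Y-bd u w δu≢δw = sum-zero term
      where
      term : ∀ k → X u k * Y k w ≈ 0#
      term k with δ u ℕ.≟ δ k
      ... | yes δu≡δk = ≈.trans (*-congˡ (Y-bd k w (δu≢δw ∘ ≡.trans δu≡δk))) (zeroʳ _)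
      ... | no δu≢δk  = ≈.trans (*-congʳ (X-bd u k δu≢δk)) (zeroˡ _)

    blockDiagonal-⊛-D : ∀ {X} → BlockDiagonal δ δ X → D G ⊛ X ≋ X ⊛ D G
    blockDiagonal-⊛-D {X} X-bd u v =
      ≈.trans (D-⊛ G X u v) (≈.trans (entry (δ u ℕ.≟ δ v)) (≈.sym (⊛-D G X u v)))
      where
      entry : Dec (δ u ≡ δ v) → embed (δ u) * X u v ≈ X u v * embed (δ v)
      entry (yes δu≡δv) = ≈.trans (*-comm _ _) (*-congˡ (≈.reflexive (cong embed δu≡δv)))
      entry (no δu≢δv)  = begin
        embed (δ u) * X u v  ≈⟨ *-congˡ (X-bd u v δu≢δv) ⟩
        embed (δ u) * 0#     ≈⟨ zeroʳ _ ⟩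
        0#                   ≈⟨ zeroˡ _ ⟨
        0# * embed (δ v)     ≈⟨ *-congʳ (X-bd u v δu≢δv) ⟨
        X u v * embed (δ v)  ∎
        where open ≈-Reasoning

    blocks : (ℕ → Mat n) → Mat n
    blocks X u v = if does (δ u ℕ.≟ δ v) then X (δ u) u v else 0#

    blocks-blockDiagonal : ∀ X → BlockDiagonal δ δ (blocks X)
    blocks-blockDiagonal X u v δu≢δv =
      ≈.reflexive (cong (λ b → if b then X (δ u) u v else 0#) (dec-false (δ u ℕ.≟ δ v) δu≢δv))

    blocks-entry : ∀ X {d u v} → δ u ≡ d → δ v ≡ d → blocks X u v ≈ X d u v
    blocks-entry X {u = u} {v} refl δv≡δu =
      ≈.reflexive (cong (λ b → if b then X (δ u) u v else 0#) (dec-true (δ u ℕ.≟ δ v) (≡.sym δv≡δu)))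

    blocks-inverse : ∀ X Y →
      (∀ d u w → δ u ≡ d → δ w ≡ d → blockMul G d (X d) (Y d) u w ≈ I u w) →
      blocks X ⊛ blocks Y ≋ I
    blocks-inverse X Y blockwise u w with δ u ℕ.≟ δ w
    ... | no δu≢δw  =
      ≈.trans (⊛-blockDiagonal (blocks-blockDiagonal X) (blocks-blockDiagonal Y) u w δu≢δw)
              (≈.sym (I-offDiagonal (δu≢δw ∘ cong δ)))
    ... | yes δu≡δw = begin
      (blocks X ⊛ blocks Y) u w
        ≈⟨ ⊛≈blockMulˡ (blocks Y) (blocks-blockDiagonal X) u w ⟩
      blockMul G (δ u) (blocks X) (blocks Y) u w
        ≈⟨ blockMul-cong (blocks X) (X (δ u)) (blocks Y) (Y (δ u)) (λ k δk≡δu →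
             *-cong (blocks-entry X refl δk≡δu) (blocks-entry Y δk≡δu (≡.sym δu≡δw))) ⟩
      blockMul G (δ u) (X (δ u)) (Y (δ u)) u w
        ≈⟨ blockwise (δ u) u w refl (≡.sym δu≡δw) ⟩
      I u w
        ∎
      where open ≈-Reasoning

  BlockSimilar⇒DegreeSimilar : ∀ {n} {G H : Graph n} → BlockSimilar G H → DegreeSimilar G H
  BlockSimilar⇒DegreeSimilar {G = G} {H} (δ≗δ′ , M , N , M-inverse , N-inverse , A-conj) =
    blocks M , blocks N , blocks-inverse M N M-inverse , blocks-inverse N M N-inverse , A-conj′ , D-conj′
    where
    open Blocks G
    δ = degree G

    A-conj′ : blocks N ⊛ A G ⊛ blocks M ≋ A H
    A-conj′ u w = begin
      (blocks N ⊛ A G ⊛ blocks M) u w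
        ≈⟨ ⊛-assoc (blocks N) (A G) (blocks M) u w ⟩
      (blocks N ⊛ (A G ⊛ blocks M)) u w
        ≈⟨ ⊛≈blockMulˡ (A G ⊛ blocks M) (blocks-blockDiagonal N) u w ⟩
      blockMul G (δ u) (blocks N) (A G ⊛ blocks M) u w
        ≈⟨ blockMul-cong (blocks N) (N (δ u)) (A G ⊛ blocks M) (blockMul G (δ w) (A G) (M (δ w)))
             (λ k δk≡δu → *-cong (blocks-entry N refl δk≡δu) (A⊛M-entry k)) ⟩
      blockMul G (δ u) (N (δ u)) (blockMul G (δ w) (A G) (M (δ w))) u w
        ≈⟨ A-conj (δ u) (δ w) u w refl refl ⟩
      A H u w
        ∎
      where
      open ≈-Reasoning
      A⊛M-entry : ∀ k → (A G ⊛ blocks M) k w ≈ blockMul G (δ w) (A G) (M (δ w)) k w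
      A⊛M-entry k = ≈.trans (⊛≈blockMulʳ (A G) (blocks-blockDiagonal M) k w)
        (blockMul-cong (A G) (A G) (blocks M) (M (δ w)) λ l δl≡δw → *-congˡ (blocks-entry M δl≡δw refl))

    D-conj′ : blocks N ⊛ D G ⊛ blocks M ≋ D H
    D-conj′ = begin
      blocks N ⊛ D G ⊛ blocks M      ≈⟨ ⊛-assoc (blocks N) (D G) (blocks M) ⟩
      blocks N ⊛ (D G ⊛ blocks M)    ≈⟨ ⊛-cong ≋.refl (blockDiagonal-⊛-D (blocks-blockDiagonal M)) ⟩
      blocks N ⊛ (blocks M ⊛ D G)    ≈⟨ ⊛-assoc (blocks N) (blocks M) (D G) ⟨
      blocks N ⊛ blocks M ⊛ D G      ≈⟨ ⊛-cong (blocks-inverse N M N-inverse) ≋.refl ⟩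
      I ⊛ D G                        ≈⟨ ⊛-identityˡ (D G) ⟩
      D G                            ≈⟨ D-cong {G = G} {H} δ≗δ′ ⟩
      D H                            ∎
      where open ≋-Reasoning

  -- Characteristic zero

  x*y≈x*z⇒y≉z⇒x≈0 : ∀ x y z → x * y ≈ x * z → ¬ (y ≈ z) → x ≈ 0#
  x*y≈x*z⇒y≉z⇒x≈0 x y z xy≈xz y≉z = begin
    x                  ≈⟨ *-identityʳ x ⟨
    x * 1#             ≈⟨ *-congˡ (proj₂ y-z-invertible) ⟨
    x * ((y - z) * w)  ≈⟨ *-assoc _ _ _ ⟨
    x * (y - z) * w    ≈⟨ *-congʳ (≈.trans (x[y-z]≈xy-xz x y z) (x≈y⇒x∙y⁻¹≈ε xy≈xz)) ⟩
    0# * w             ≈⟨ zeroˡ w ⟩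
    0#                 ∎
    where
    open ≈-Reasoning
    y-z-invertible = inverse (y - z) (y≉z ∘ x∙y⁻¹≈ε⇒x≈y y z)
    w = proj₁ y-z-invertible

  embed-injective : CharZero → ∀ a b → embed a ≈ embed b → a ≡ b
  embed-injective cz zero    zero    _ = refl
  embed-injective cz zero    (suc b) e = ⊥-elim (cz b (≈.sym e))
  embed-injective cz (suc a) zero    e = ⊥-elim (cz a e)
  embed-injective cz (suc a) (suc b) e = cong suc (embed-injective cz a b (∙-cancelˡ 1# _ _ e))

  embed-+ : ∀ a b → embed (a ℕ.+ b) ≈ embed a + embed b
  embed-+ zero    b = ≈.sym (+-identityˡ _)
  embed-+ (suc a) b = ≈.trans (+-congˡ (embed-+ a b)) (≈.sym (+-assoc _ _ _))

  embed-sum : ∀ {n} (h : Fin n → ℕ) → embed (ℕSum.sum h) ≈ sum (embed ∘ h)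
  embed-sum {zero}  h = ≈.refl
  embed-sum {suc n} h =
    ≈.trans (embed-+ (h fzero) (ℕSum.sum (h ∘ fsuc))) (+-congˡ (embed-sum (h ∘ fsuc)))

  fibreSize : ∀ {n} → (Fin n → ℕ) → ℕ → Carrier
  fibreSize δ e = sum (λ v → if does (δ v ℕ.≟ e) then 1# else 0#)

  embed-count : ∀ {n} (δ : Fin n → ℕ) e → embed (count δ e) ≈ fibreSize δ e
  embed-count δ e = ≈.trans (embed-sum (λ v → if does (δ v ℕ.≟ e) then 1 else 0))
                            (sum-cong-≋ λ v → embed-indicator (does (δ v ℕ.≟ e)))
    where
    embed-indicator : ∀ b → embed (if b then 1 else 0) ≈ (if b then 1# else 0#)
    embed-indicator true  = +-identityʳ 1#
    embed-indicator false = ≈.refl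

  -- Compare the traces of MN = I and NM = I restricted to the vertices of degree e.
  fibreSize-invariant : ∀ {n} {δ δ′ : Fin n → ℕ} {M N : Mat n} → M ⊛ N ≋ I → N ⊛ M ≋ I →
    BlockDiagonal δ δ′ M → ∀ e → fibreSize δ e ≈ fibreSize δ′ e
  fibreSize-invariant {δ = δ} {δ′} {M} {N} M⊛N≋I N⊛M≋I M-bd e = begin
    sum χ
      ≈⟨ sum-cong-≋ (λ u → times-diagonal M⊛N≋I (χ u) u) ⟩
    sum (λ u → χ u * (M ⊛ N) u u)
      ≈⟨ sum-cong-≋ (λ u → *-distribˡ-sum (χ u) (λ k → M u k * N k u)) ⟩
    sum (λ u → sum (λ k → χ u * (M u k * N k u)))
      ≈⟨ sum-cong-≋ (λ u → sum-cong-≋ λ k → χ-transfer u k) ⟩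
    sum (λ u → sum (λ k → χ′ k * (M u k * N k u)))
      ≈⟨ ∑-comm (λ u k → χ′ k * (M u k * N k u)) ⟩
    sum (λ k → sum (λ u → χ′ k * (M u k * N k u)))
      ≈⟨ sum-cong-≋ (λ k → sum-cong-≋ λ u → *-congˡ (*-comm (M u k) (N k u))) ⟩
    sum (λ k → sum (λ u → χ′ k * (N k u * M u k)))
      ≈⟨ sum-cong-≋ (λ k → *-distribˡ-sum (χ′ k) (λ u → N k u * M u k)) ⟨
    sum (λ k → χ′ k * (N ⊛ M) k k)
      ≈⟨ sum-cong-≋ (λ k → times-diagonal N⊛M≋I (χ′ k) k) ⟨
    sum χ′
      ∎
    where
    open ≈-Reasoning
    χ χ′ : Fin _ → Carrier
    χ  u = if does (δ u ℕ.≟ e) then 1# else 0#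
    χ′ k = if does (δ′ k ℕ.≟ e) then 1# else 0#

    times-diagonal : ∀ {X Y : Mat _} → X ⊛ Y ≋ I → ∀ x u → x ≈ x * (X ⊛ Y) u u
    times-diagonal X⊛Y≋I x u =
      ≈.sym (≈.trans (*-congˡ (≈.trans (X⊛Y≋I u u) (I-diagonal u))) (*-identityʳ x))

    χ-transfer : ∀ u k → χ u * (M u k * N k u) ≈ χ′ k * (M u k * N k u)
    χ-transfer u k with δ u ℕ.≟ δ′ k
    ... | yes δu≡δ′k =
      ≈.reflexive (cong (λ a → (if does (a ℕ.≟ e) then 1# else 0#) * (M u k * N k u)) δu≡δ′k)
    ... | no δu≢δ′k  = ≈.trans (vanishes (χ u)) (≈.sym (vanishes (χ′ k)))
      where
      vanishes : ∀ x → x * (M u k * N k u) ≈ 0#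
      vanishes x = ≈.trans (*-congˡ (≈.trans (*-congʳ (M-bd u k δu≢δ′k)) (zeroˡ _))) (zeroʳ x)

  intertwiner-blockDiagonal : CharZero → ∀ {n} {G H : Graph n} {X : Mat n} →
    D G ⊛ X ≋ X ⊛ D H → BlockDiagonal (degree G) (degree H) X
  intertwiner-blockDiagonal cz {G = G} {H} {X} D⊛X≋X⊛D u v δu≢δ′v =
    x*y≈x*z⇒y≉z⇒x≈0 (X u v) (embed (degree G u)) (embed (degree H v))
      (≈.trans (*-comm _ _) (≈.trans (≈.sym (D-⊛ G X u v))
                            (≈.trans (D⊛X≋X⊛D u v) (⊛-D H X u v))))
      (δu≢δ′v ∘ embed-injective cz (degree G u) (degree H v))

  DegreeSimilar-blockDiagonal : CharZero → ∀ {n} {G H : Graph n} (S : DegreeSimilar G H) →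
    BlockDiagonal (degree G) (degree H) (proj₁ S)
  DegreeSimilar-blockDiagonal cz {G = G} {H} (M , N , M⊛N≋I , _ , _ , D-conj) =
    intertwiner-blockDiagonal cz {G = G} {H} (conjugate-intertwines M⊛N≋I {D G} {D H} D-conj)

  DegreeSimilar⇒same-count : CharZero → ∀ {n} {G H : Graph n} → DegreeSimilar G H →
    ∀ e → count (degree G) e ≡ count (degree H) e
  DegreeSimilar⇒same-count cz {G = G} {H} S@(M , N , M⊛N≋I , N⊛M≋I , _) e =
    embed-injective cz (count (degree G) e) (count (degree H) e) (begin
      embed (count (degree G) e)
        ≈⟨ embed-count (degree G) e ⟩
      fibreSize (degree G) e
        ≈⟨ fibreSize-invariant {δ = degree G} {degree H} {M} {N} M⊛N≋I N⊛M≋I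
             (DegreeSimilar-blockDiagonal cz {G = G} {H} S) e ⟩
      fibreSize (degree H) e
        ≈⟨ embed-count (degree H) e ⟨
      embed (count (degree H) e)
        ∎)
    where open ≈-Reasoning

  DegreeSimilar⇒BlockSimilar : CharZero → ∀ {n} {G H : Graph n} →
    (∀ v → degree G v ≡ degree H v) → DegreeSimilar G H → BlockSimilar G H
  DegreeSimilar⇒BlockSimilar cz {G = G} {H} δ≗δ′ S@(M , N , M⊛N≋I , N⊛M≋I , A-conj , _) =
    δ≗δ′ , (λ _ → M) , (λ _ → N) , M-inverse , N-inverse , A-conj′
    where
    open Blocks G

    M-bd : BlockDiagonal (degree G) (degree G) M
    M-bd u v δu≢δv = DegreeSimilar-blockDiagonal cz {G = G} {H} S u v
      (λ e → δu≢δv (≡.trans e (≡.sym (δ≗δ′ v))))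

    N-bd : BlockDiagonal (degree G) (degree G) N
    N-bd u v δu≢δv = DegreeSimilar-blockDiagonal cz {G = H} {G} (DegreeSimilar-sym {G = G} {H} S) u v
      (λ e → δu≢δv (≡.trans (δ≗δ′ u) e))

    M-inverse : ∀ d u w → degree G u ≡ d → degree G w ≡ d → blockMul G d M N u w ≈ I u w
    M-inverse _ u w refl _ = ≈.trans (≈.sym (⊛≈blockMulˡ N M-bd u w)) (M⊛N≋I u w)

    N-inverse : ∀ d u w → degree G u ≡ d → degree G w ≡ d → blockMul G d N M u w ≈ I u w
    N-inverse _ u w refl _ = ≈.trans (≈.sym (⊛≈blockMulˡ M N-bd u w)) (N⊛M≋I u w)

    A-conj′ : ∀ d e u w → degree G u ≡ d → degree G w ≡ e →
      blockMul G d N (blockMul G e (A G) M) u w ≈ A H u w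
    A-conj′ _ _ u w refl refl = begin
      blockMul G (degree G u) N (blockMul G (degree G w) (A G) M) u w
        ≈⟨ blockMul-cong N N (A G ⊛ M) (blockMul G (degree G w) (A G) M)
             (λ k _ → *-congˡ (⊛≈blockMulʳ (A G) M-bd k w)) ⟨
      blockMul G (degree G u) N (A G ⊛ M) u w
        ≈⟨ ⊛≈blockMulˡ (A G ⊛ M) N-bd u w ⟨
      (N ⊛ (A G ⊛ M)) u w
        ≈⟨ ⊛-assoc N (A G) M u w ⟨
      (N ⊛ A G ⊛ M) u w
        ≈⟨ A-conj u w ⟩
      A H u w
        ∎
      where open ≈-Reasoning

  DegreeSimilar⇒RelabelledBlockSimilar : CharZero → ∀ {n} {G₁ G₂ : Graph n} →
    DegreeSimilar G₁ G₂ → RelabelledBlockSimilar G₁ G₂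
  DegreeSimilar⇒RelabelledBlockSimilar cz {G₁ = G₁} {G₂} S =
    π , Perm.id , DegreeSimilar⇒BlockSimilar cz {G = relabel π G₁} {G₂} same-degree
                   (DegreeSimilar-relabel π {G₁} {relabel π G₁} {G₂} (relabel-isRelabelling π G₁) S)
    where
    sorting = permutation-from-count (degree G₁) (degree G₂) (DegreeSimilar⇒same-count cz {G = G₁} {G₂} S)
    π = proj₁ sorting

    same-degree : ∀ v → degree (relabel π G₁) v ≡ degree G₂ v
    same-degree v =
      ≡.trans (degree-relabel π {G₁} {relabel π G₁} (relabel-isRelabelling π G₁) v) (proj₂ sorting v)

  RelabelledBlockSimilar⇒DegreeSimilar : ∀ {n} {G₁ G₂ : Graph n} →
    RelabelledBlockSimilar G₁ G₂ → DegreeSimilar G₁ G₂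
  RelabelledBlockSimilar⇒DegreeSimilar {G₁ = G₁} {G₂} (σ₁ , σ₂ , B) =
    DegreeSimilar-sym {G = G₂} {G₁} (DegreeSimilar-unrelabel σ₂ {G₂} {G₁}
      (DegreeSimilar-sym {G = G₁} {relabel σ₂ G₂} (DegreeSimilar-unrelabel σ₁ {G₁} {relabel σ₂ G₂}
        (BlockSimilar⇒DegreeSimilar {G = relabel σ₁ G₁} {relabel σ₂ G₂} B))))

mainTheorem1 : ∀ {c ℓ} (F : Field c ℓ) → MatrixOver.CharZero F →
    (n : ℕ) (G₁ G₂ : Graph n) →
    MatrixOver.DegreeSimilar F G₁ G₂ ⇔ MatrixOver.RelabelledBlockSimilar F G₁ G₂
mainTheorem1 F cz n G₁ G₂ =
  mk⇔ (DegreeSimilar⇒RelabelledBlockSimilar F cz {G₁ = G₁} {G₂})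
      (RelabelledBlockSimilar⇒DegreeSimilar F {G₁ = G₁} {G₂})
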